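{- Let $\mathcal{C}$ be a standard closure system over a finite set $U$ with acyclic split $(U_1,U_2)$, and let $\mathcal{C}_1=\{C\cap U_1 : C\in\mathcal{C},\ U_2\subseteq C\}$, $\mathcal{C}_2=\{C\in\mathcal{C}: C\subseteq U_2\}$. Let $C_2\in\mathcal{C}_2$ with $C_2\neq U_2$ and $C_1\in\mathcal{C}_1$ such that $C_1\cup C_2$ is an extension of $C_2$ that is not inclusion-maximal among the extensions of $C_2$. Then $C_1\cup C_2$ is not a meet-irreducible element of $\mathcal{C}$.
   Context: A closure system over $U$ is a family $\mathcal{C}$ of subsets of $U$ with $U\in\mathcal{C}$ and closed under intersection; with closure operator $\phi(X)=\bigcap\{C\in\mathcal{C}: X\subseteq C\}$ it is standard if $\phi(\{u\})\setminus\{u\}\in\mathcal{C}$ for every $u\in U$. A meet-irreducible element of $\mathcal{C}$ is a closed set $M\neq U$ such that $M=C\cap C'$ with $C,C'\in\mathcal{C}$ implies $M=C$ or $M=C'$ (equivalently, $M$ has exactly one upper cover in $\mathcal{C}$). An implication over $U$ is written $A \to b$ with $A \subseteq U$ nonempty and $b \in U$; an implicational base is a finite set of implications; $\Sigma$ is an implicational base for $\mathcal{C}$ if $\mathcal{C}$ is exactly the family of $C\subseteq U$ such that $A\subseteq C$ implies $b\in C$ for all $A\to b\in\Sigma$. For $X\subseteq U$, $\Sigma[X]=\{A\to b\in\Sigma: A\cup\{b\}\subseteq X\}$, and for a bipartition $(U_1,U_2)$ of $U$, $\Sigma[U_1,U_2]:=\Sigma\setminus(\Sigma[U_1]\cup\Sigma[U_2])$.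 $(U_1,U_2)$ (nonempty disjoint parts, $U_2\in\mathcal{C}$) is an acyclic split of $\mathcal{C}$ if there is an implicational base $\Sigma$ for $\mathcal{C}$ in which every premise is contained in $U_1$ or in $U_2$ and every $A\to b\in\Sigma[U_1,U_2]$ has $A\subseteq U_1$. For $C_2\in\mathcal{C}_2$, an extension of $C_2$ is a set $C\in\mathcal{C}$ with $C\cap U_2=C_2$. -}

module Defs where

open import Data.Nat using (ℕ)
open import Data.Fin using (Fin)
open import Data.Fin.Subset renaming (_∈_ to _∈ₛ_)
open import Data.Product using (Σ; ∃; _×_; _,_)
open import Data.Sum using (_⊎_)
open import Data.List using (List)
open import Data.List.Membership.Propositional renaming (_∈_ to _∈ₗ_) using ()
open import Relation.Binary.PropositionalEquality using (_≡_; _≢_)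
open import Relation.Nullary using (¬_)

-- The ground set U is Fin n; a family of subsets 𝒞 is a predicate on Subset n.
Family : ℕ → Set₁
Family n = Subset n → Set

IsClosureSystem : ∀ {n} → Family n → Set
IsClosureSystem {n} 𝒞 = 𝒞 ⊤ × (∀ C D → 𝒞 C → 𝒞 D → 𝒞 (C ∩ D))

_∈φ_ : ∀ {n} → Fin n → (Family n × Subset n) → Set
_∈φ_ {n} x (𝒞 , X) = ∀ C → 𝒞 C → X ⊆ C → x ∈ₛ C

-- standard: φ({u}) \ {u} ∈ 𝒞 for every u
IsStandard : ∀ {n} → Family n → Set
IsStandard {n} 𝒞 = ∀ (u : Fin n) → Σ (Subset n) λ S →
  (∀ x → (x ∈ₛ S → (x ≢ u × x ∈φ (𝒞 , ⁅ u ⁆))) × ((x ≢ u × x ∈φ (𝒞 , ⁅ u ⁆)) → x ∈ₛ S))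
  × 𝒞 S

record Implication (n : ℕ) : Set where
  constructor _⇒_
  field
    premise    : Subset n
    conclusion : Fin n
open Implication public

ImplBase : ℕ → Set
ImplBase n = List (Implication n)

Respects : ∀ {n} → ImplBase n → Subset n → Set
Respects Σ' C = ∀ imp → imp ∈ₗ Σ' → premise imp ⊆ C → conclusion imp ∈ₛ C

IsImplBaseFor : ∀ {n} → ImplBase n → Family n → Set
IsImplBaseFor Σ' 𝒞 =
  (∀ imp → imp ∈ₗ Σ' → Nonempty (premise imp)) ×
  (∀ C → (𝒞 C → Respects Σ' C) × (Respects Σ' C → 𝒞 C))

InsideOf : ∀ {n} → Implication n → Subset n → Set
InsideOf imp X = (premise imp ∪ ⁅ conclusion imp ⁆) ⊆ X

IsAcyclicSplit : ∀ {n} → Family n → Subset n → Subset n → Set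
IsAcyclicSplit {n} 𝒞 U₁ U₂ =
  (U₁ ≡ ∁ U₂) × Nonempty U₁ × Nonempty U₂ × 𝒞 U₂ ×
  Σ (ImplBase n) λ Σ' → IsImplBaseFor Σ' 𝒞 ×
    (∀ imp → imp ∈ₗ Σ' → premise imp ⊆ U₁ ⊎ premise imp ⊆ U₂) ×
    (∀ imp → imp ∈ₗ Σ' → ¬ InsideOf imp U₁ → ¬ InsideOf imp U₂ → premise imp ⊆ U₁)

In𝒞₁ : ∀ {n} → Family n → Subset n → Subset n → Subset n → Set
In𝒞₁ {n} 𝒞 U₁ U₂ X = Σ (Subset n) λ C → 𝒞 C × U₂ ⊆ C × X ≡ C ∩ U₁

In𝒞₂ : ∀ {n} → Family n → Subset n → Subset n → Set
In𝒞₂ 𝒞 U₂ X = 𝒞 X × X ⊆ U₂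

IsExtension : ∀ {n} → Family n → Subset n → Subset n → Subset n → Set
IsExtension 𝒞 U₂ C₂ C = 𝒞 C × C ∩ U₂ ≡ C₂

IsMeetIrreducible : ∀ {n} → Family n → Subset n → Set
IsMeetIrreducible 𝒞 M = 𝒞 M × M ≢ ⊤ ×
  (∀ C D → 𝒞 C → 𝒞 D → M ≡ C ∩ D → M ≡ C ⊎ M ≡ D)

module Submission where

open import Defs
open import Data.Nat using (ℕ)
open import Data.Fin.Subset using (Subset; _∪_; _∩_; ∁; _⊆_; _⊂_)
open import Data.Fin.Subset.Properties
  using (_∈?_; ⊆-antisym; ⊂-irref; p⊂q⇒p⊆q; p⊆p∪q; p∩q⊆q;
         x∈p∩q⁺; x∈p∩q⁻; x∈p∪q⁺; x∈p∪q⁻; x∉p⇒x∈∁p)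
open import Data.Product using (Σ; _×_; _,_; proj₁)
open import Data.Sum using (inj₁; inj₂)
open import Function using (_∘_)
open import Relation.Binary.PropositionalEquality using (_≢_; _≡_; refl; sym; trans)
open import Relation.Nullary using (¬_; yes; no)

-- Write M = C₁ ∪ C₂, let C be the closed set with U₂ ⊆ C and C ∩ U₁ = C₁, and
-- let D be the larger extension of C₂. Splitting along U₂ shows M = C ∩ D,
-- while M ≠ C (C contains U₂, M meets it only in C₂ ≠ U₂) and M ≠ D. So M is a
-- meet of two strictly larger closed sets.

properMeet⇒¬meetIrreducible : ∀ {n} {𝒞 : Family n} {M C D : Subset n} →
  𝒞 C → 𝒞 D → M ≡ C ∩ D → M ≢ C → M ≢ D → ¬ IsMeetIrreducible 𝒞 M
properMeet⇒¬meetIrreducible C∈𝒞 D∈𝒞 M≡C∩D M≢C M≢D (_ , _ , irreducible)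
  with irreducible _ _ C∈𝒞 D∈𝒞 M≡C∩D
... | inj₁ M≡C = M≢C M≡C
... | inj₂ M≡D = M≢D M≡D

p∩∁u∪q∩u≡p∩q : ∀ {n} {p q u : Subset n} →
  u ⊆ p → p ∩ ∁ u ⊆ q → (p ∩ ∁ u) ∪ (q ∩ u) ≡ p ∩ q
p∩∁u∪q∩u≡p∩q {p = p} {q} {u} u⊆p p∩∁u⊆q = ⊆-antisym parts⊆meet meet⊆parts
  where
  parts⊆meet : (p ∩ ∁ u) ∪ (q ∩ u) ⊆ p ∩ q
  parts⊆meet x∈ with x∈p∪q⁻ (p ∩ ∁ u) (q ∩ u) x∈
  ... | inj₁ x∈p∩∁u = x∈p∩q⁺ (proj₁ (x∈p∩q⁻ p (∁ u) x∈p∩∁u) , p∩∁u⊆q x∈p∩∁u)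
  ... | inj₂ x∈q∩u with x∈p∩q⁻ q u x∈q∩u
  ...   | x∈q , x∈u = x∈p∩q⁺ (u⊆p x∈u , x∈q)

  meet⊆parts : p ∩ q ⊆ (p ∩ ∁ u) ∪ (q ∩ u)
  meet⊆parts {x} x∈ with x∈p∩q⁻ p q x∈ | x ∈? u
  ... | x∈p , x∈q | yes x∈u = x∈p∪q⁺ (inj₂ (x∈p∩q⁺ (x∈q , x∈u)))
  ... | x∈p , x∈q | no x∉u  = x∈p∪q⁺ (inj₁ (x∈p∩q⁺ (x∈p , x∉p⇒x∈∁p x∉u)))

u⊆p∧q∩u≢u⇒q≢p : ∀ {n} {p q u : Subset n} → u ⊆ p → q ∩ u ≢ u → q ≢ p
u⊆p∧q∩u≢u⇒q≢p {u = u} u⊆p q∩u≢u refl =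
  q∩u≢u (⊆-antisym (p∩q⊆q _ u) (λ x∈u → x∈p∩q⁺ (u⊆p x∈u , x∈u)))

lemma2 : ∀ {n : ℕ} (𝒞 : Family n) (U₁ U₂ : Subset n) →
    IsClosureSystem 𝒞 → IsStandard 𝒞 → IsAcyclicSplit 𝒞 U₁ U₂ →
    (C₂ C₁ : Subset n) → In𝒞₂ 𝒞 U₂ C₂ → C₂ ≢ U₂ → In𝒞₁ 𝒞 U₁ U₂ C₁ →
    IsExtension 𝒞 U₂ C₂ (C₁ ∪ C₂) →
    (Σ (Subset n) λ D → IsExtension 𝒞 U₂ C₂ D × (C₁ ∪ C₂) ⊂ D) →
    ¬ IsMeetIrreducible 𝒞 (C₁ ∪ C₂)
lemma2 𝒞 U₁ U₂ _ _ (refl , _) C₂ C₁ _ C₂≢U₂ (C , C∈𝒞 , U₂⊆C , refl)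
       (_ , M∩U₂≡C₂) (D , (D∈𝒞 , refl) , M⊂D) =
  properMeet⇒¬meetIrreducible C∈𝒞 D∈𝒞
    (p∩∁u∪q∩u≡p∩q U₂⊆C (p⊂q⇒p⊆q M⊂D ∘ p⊆p∪q (D ∩ U₂)))
    (u⊆p∧q∩u≢u⇒q≢p U₂⊆C (C₂≢U₂ ∘ trans (sym M∩U₂≡C₂)))
    (λ M≡D → ⊂-irref M≡D M⊂D)
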